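{- For the graph $G=K_k\,\square\,P_\ell$ with $k,\ell\ge 3$, $\bar{\gamma}_p(G)=(k-2)\left\lfloor\frac{\ell-1}{2}\right\rfloor$.
   Context: $K_k$ is the complete graph on $k$ vertices and $P_\ell$ the path on $\ell$ vertices. The Cartesian product $G\,\square\,H$ has vertex set $V(G)\times V(H)$, with $(u_1,v_1)$ adjacent to $(u_2,v_2)$ iff either $u_1=u_2$ and $\{v_1,v_2\}\in E(H)$, or $\{u_1,u_2\}\in E(G)$ and $v_1=v_2$. For $v\in V$, $N[v]$ is the closed neighborhood; for $S\subseteq V$, $N[S]=\bigcup_{v\in S}N[v]$. Define $\mathcal{P}^0(S)=N[S]$, $\mathcal{P}^{i+1}(S)=\mathcal{P}^i(S)\cup\{w : \{w\}=N[v]\setminus\mathcal{P}^i(S)\text{ for some } v\in\mathcal{P}^i(S)\}$, with eventual value $\mathcal{P}^\infty(S)$. $S$ is a power dominating set (PDS) if $\mathcal{P}^\infty(S)=V$, and a failed power dominating set (FPDS) otherwise. $\bar{\gamma}_p(G)$ is the maximum cardinality of an FPDS of $G$. -}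

module Defs where

open import Level using (Level; 0ℓ)
open import Data.Nat using (ℕ; suc; _≤_; _∸_; _*_; _/_)
open import Data.Fin using (Fin; toℕ)
open import Data.Product using (_×_; _,_; ∃-syntax)
open import Data.Sum using (_⊎_)
open import Data.List using (List; length)
open import Data.List.Membership.Propositional using (_∈_)
open import Data.List.Relation.Unary.Unique.Propositional using (Unique)
open import Relation.Binary.PropositionalEquality using (_≡_; _≢_)
open import Relation.Nullary using (¬_)

record Graph : Set₁ where
  field
    V   : Set
    Adj : V → V → Set

module _ (G : Graph) where
  open Graph G

  InN : V → V → Set
  InN v w = (w ≡ v) ⊎ Adj v w

  -- w ∈ P^∞(S), i.e. the least set containing N[S] and closed under the
  -- propagation rule: if v is observed and w is the unique vertex of N[v]
  -- not yet observed, then w becomes observed.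
  data Observed (S : List V) : V → Set where
    dom   : ∀ {v w} → v ∈ S → InN v w → Observed S w
    force : ∀ {v w} → Observed S v → InN v w →
            (∀ u → InN v u → u ≢ w → Observed S u) → Observed S w

  IsPDS : List V → Set
  IsPDS S = ∀ w → Observed S w

  IsFPDS : List V → Set
  IsFPDS S = ¬ IsPDS S

  -- γ̄_p(G) = m : m is the maximum cardinality of a failed power dominating
  -- set (sets are duplicate-free lists, cardinality = length).
  FailedPowerDominationNumber : ℕ → Set
  FailedPowerDominationNumber m =
    (∃[ S ] (Unique S × IsFPDS S × length S ≡ m)) ×
    (∀ S → Unique S → IsFPDS S → length S ≤ m)

K : ℕ → Graph
K k = record { V = Fin k ; Adj = λ i j → i ≢ j }

P : ℕ → Graph
P ℓ = record { V = Fin ℓ ; Adj = λ i j → (toℕ j ≡ suc (toℕ i)) ⊎ (toℕ i ≡ suc (toℕ j)) }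

_□_ : Graph → Graph → Graph
G □ H = record
  { V   = Graph.V G × Graph.V H
  ; Adj = λ { (u₁ , v₁) (u₂ , v₂) →
              ((u₁ ≡ u₂) × Graph.Adj H v₁ v₂) ⊎ (Graph.Adj G u₁ u₂ × (v₁ ≡ v₂)) }
  }

module Submission where

-- Call rows 0 and 1 small and the other k - 2 rows big, and call
-- a layer marked if it is odd and not the last one.  The small rows of the
-- unmarked layers form a fort: no vertex outside it has exactly one closed
-- neighbour in it.  The big rows of the ⌊(ℓ - 1)/2⌋ marked layers form a set S
-- whose closed neighbourhood avoids the fort, so by the general fort lemma
-- (`fort-unobserved`) the fort is never observed and S fails.
--
-- Let S fail and let U p be the number of unobserved vertices
-- ("holes") of layer p - 1, with empty virtual layers at both ends.  Because
-- propagation is stuck, a hole-free layer has equally many holes on both sides,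
-- a layer with one hole has at least k - 1 holes beside it, and some layer has
-- a hole.  Every vertex of S lies in a hole-free layer and in a row whose next
-- vertex is observed, so |S| is at most a weighted count of hole-free layers;
-- a left-to-right scan over U (`HoleProfile.Scan`) bounds that count by
-- (k - 2)⌊(ℓ - 1)/2⌋.  Counting needs observedness to be decidable; since the
-- bound itself is decidable we may assume this by double-negation elimination
-- over the finite vertex set.

open import Defs
open import Data.Bool using (Bool; true; false; not; _∨_; _∧_; if_then_else_)
open import Data.Bool.Properties using (T-≡; T-∧)
open import Data.Empty using (⊥; ⊥-elim)
open import Data.Fin using (Fin; zero; suc; toℕ; fromℕ<)
open import Data.Fin.Properties
  using (toℕ-injective; toℕ-fromℕ<; toℕ<n; toℕ-inject₁; toℕ-fromℕ)
  renaming (_≟_ to _≟ᶠ_; suc-injective to fsuc-injective)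
open import Data.List using (List; []; _∷_; length; tabulate; cartesianProduct; map)
open import Data.List.Properties using (length-++; length-map; length-tabulate)
open import Data.List.Membership.Propositional using (_∈_)
open import Data.List.Membership.Propositional.Properties using (∈-tabulate⁻; ∈-cartesianProduct⁻)
open import Data.List.Relation.Unary.All using (lookup)
open import Data.List.Relation.Unary.AllPairs using (_∷_)
open import Data.List.Relation.Unary.Any using (here; there)
open import Data.List.Relation.Unary.Unique.Propositional using (Unique)
open import Data.List.Relation.Unary.Unique.Propositional.Properties using (tabulate⁺; cartesianProduct⁺)
open import Data.Nat using (ℕ; zero; suc; _+_; _*_; _∸_; _/_; _≤_; _<_; _<ᵇ_; _≤?_; z≤n; s≤s; s≤s⁻¹)
open import Data.Nat.DivMod using (m*n/n≡m; /-monoˡ-≤; m/n*n≤m)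
open import Data.Nat.Properties
open import Data.Product using (∃-syntax; _×_; _,_; proj₁; proj₂)
open import Data.Product.Properties using (≡-dec)
open import Data.Sum using (_⊎_; inj₁; inj₂)
open import Function using (_∘_)
open import Function.Bundles using (Equivalence)
open import Relation.Binary.Definitions using (DecidableEquality)
open import Relation.Binary.PropositionalEquality
open import Relation.Nullary using (Dec; does; yes; no; ¬_)
open import Relation.Nullary.Decidable using (dec-true; decidable-stable; ¬¬-excluded-middle)

open import Algebra.Properties.Monoid.Sum +-0-monoid using (sum; sum-syntax; sum-cong-≗; sum-init-last)
open Equivalence using (to; from)

true≢false : ∀ {b} → b ≡ true → b ≡ false → ⊥
true≢false refl ()

sum-decrement : ∀ {n} (f g : Fin n → ℕ) (a : Fin n) → f a ≡ suc (g a) →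
                (∀ i → i ≢ a → f i ≡ g i) → sum f ≡ suc (sum g)
sum-decrement {suc n} f g zero    fa others =
  cong₂ _+_ fa (sum-cong-≗ (λ i → others (suc i) (λ ())))
sum-decrement {suc n} f g (suc a) fa others = begin
  f zero + sum (f ∘ suc)       ≡⟨ cong₂ _+_ (others zero (λ ())) tail-decrement ⟩
  g zero + suc (sum (g ∘ suc)) ≡⟨ +-suc (g zero) _ ⟩
  suc (sum g)                  ∎
  where
  open ≡-Reasoning
  tail-decrement : sum (f ∘ suc) ≡ suc (sum (g ∘ suc))
  tail-decrement = sum-decrement (f ∘ suc) (g ∘ suc) a fa
                     (λ i i≢a → others (suc i) (i≢a ∘ fsuc-injective))

prefix-sum : (ℕ → ℕ) → ℕ → ℕ
prefix-sum f zero    = 0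
prefix-sum f (suc t) = prefix-sum f t + f t

sum-toℕ : ∀ n (f : ℕ → ℕ) → ∑[ j < n ] f (toℕ j) ≡ prefix-sum f n
sum-toℕ zero    f = refl
sum-toℕ (suc n) f = trans (sum-init-last {n} (f ∘ toℕ))
  (cong₂ _+_ (trans (sum-cong-≗ {n} (cong f ∘ toℕ-inject₁)) (sum-toℕ n f)) (cong f (toℕ-fromℕ n)))

𝟙 : Bool → ℕ
𝟙 true  = 1
𝟙 false = 0

count : ∀ {n} → (Fin n → Bool) → ℕ
count {n} f = ∑[ i < n ] 𝟙 (f i)

count-cong : ∀ {n} {f g : Fin n → Bool} → (∀ i → f i ≡ g i) → count f ≡ count g
count-cong f≗g = sum-cong-≗ (cong 𝟙 ∘ f≗g)

count-none : ∀ {n} {f : Fin n → Bool} → (∀ i → f i ≡ false) → count f ≡ 0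
count-none {zero}          none = refl
count-none {suc n} {f = f} none rewrite none zero = count-none (none ∘ suc)

count-zero : ∀ {n} (f : Fin n → Bool) → count f ≡ 0 → ∀ i → f i ≡ false
count-zero {suc n} f c zero    with f zero
... | false = refl
count-zero {suc n} f c (suc i) with f zero
... | false = count-zero (f ∘ suc) c i

count-witness : ∀ {n} (f : Fin n → Bool) {x} → count f ≡ suc x → ∃[ i ] f i ≡ true
count-witness {suc n} f c with f zero in f₀
... | true  = zero , f₀
... | false with count-witness (f ∘ suc) c
...   | i , fi = suc i , fi

count-complement : ∀ {n} (f : Fin n → Bool) → count (not ∘ f) + count f ≡ n
count-complement {zero}  f = refl
count-complement {suc n} f with f zero
... | true  = trans (+-suc _ _) (cong suc (count-complement (f ∘ suc)))
... | false = cong suc (count-complement (f ∘ suc))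

count-cover : ∀ {n} (f g h : Fin n → Bool) → (∀ i → (f i ∨ g i ∨ h i) ≡ true) →
              n ≤ count f + count g + count h
count-cover {zero}  f g h cover = z≤n
count-cover {suc n} f g h cover =
  step (f zero) (g zero) (h zero) (cover zero)
       (count-cover (f ∘ suc) (g ∘ suc) (h ∘ suc) (cover ∘ suc))
  where
  step : ∀ x y z {a b c} → (x ∨ y ∨ z) ≡ true → n ≤ a + b + c →
         suc n ≤ (𝟙 x + a) + (𝟙 y + b) + (𝟙 z + c)
  step true  y z {a} {b} {c} _ le =
    s≤s (≤-trans le (+-mono-≤ (+-monoʳ-≤ a (m≤n+m b (𝟙 y))) (m≤n+m c (𝟙 z))))
  step false true  z {a} {b} {c} _ le rewrite +-suc a b =
    s≤s (≤-trans le (+-monoʳ-≤ (a + b) (m≤n+m c (𝟙 z))))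
  step false false true {a} {b} {c} _ le rewrite +-suc (a + b) c = s≤s le

remove : ∀ {X : Set} → DecidableEquality X → (X → Bool) → X → X → Bool
remove _≟_ A x y = if does (y ≟ x) then false else A y

module _ {X : Set} (_≟_ : DecidableEquality X) (A : X → Bool) where

  remove-self : ∀ x → remove _≟_ A x x ≡ false
  remove-self x with x ≟ x
  ... | yes _   = refl
  ... | no x≢x  = ⊥-elim (x≢x refl)

  remove-other : ∀ {x y} → y ≢ x → remove _≟_ A x y ≡ A y
  remove-other {x} {y} y≢x with y ≟ x
  ... | yes y≡x = ⊥-elim (y≢x y≡x)
  ... | no _    = refl

count-remove : ∀ {n} (f : Fin n → Bool) a → f a ≡ true →
               count f ≡ suc (count (remove _≟ᶠ_ f a))
count-remove f a fa =
  sum-decrement _ _ a (trans (cong 𝟙 fa) (cong (suc ∘ 𝟙) (sym (remove-self _≟ᶠ_ f a))))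
                      (λ i i≢a → cong 𝟙 (sym (remove-other _≟ᶠ_ f i≢a)))

count-unique : ∀ {n} (f : Fin n → Bool) {a b} → count f ≡ 1 →
               f a ≡ true → f b ≡ true → b ≡ a
count-unique f {a} {b} c fa fb with b ≟ᶠ a
... | yes b≡a = b≡a
... | no  b≢a = ⊥-elim (true≢false fb (trans (sym (remove-other _≟ᶠ_ f b≢a)) no-other))
  where
  no-other : remove _≟ᶠ_ f a b ≡ false
  no-other = count-zero (remove _≟ᶠ_ f a) (suc-injective (trans (sym (count-remove f a fa)) c)) b

grid-count : ∀ {a b} → (Fin a × Fin b → Bool) → ℕ
grid-count {a} {b} A = ∑[ j < b ] count (λ i → A (i , j))

module _ {a b : ℕ} where

  _≟ᵍ_ : DecidableEquality (Fin a × Fin b)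
  _≟ᵍ_ = ≡-dec _≟ᶠ_ _≟ᶠ_

  grid-count-remove : ∀ (A : Fin a × Fin b → Bool) x → A x ≡ true →
                      grid-count A ≡ suc (grid-count (remove _≟ᵍ_ A x))
  grid-count-remove A (i₀ , j₀) Ax =
    sum-decrement _ _ j₀
      (trans (count-remove (λ i → A (i , j₀)) i₀ Ax)
             (cong suc (count-cong (λ i → sym (remove-column i)))))
      (λ j j≢j₀ → count-cong (λ i → sym (remove-other _≟ᵍ_ A {y = i , j} (j≢j₀ ∘ cong proj₂))))
    where
    remove-column : ∀ i → remove _≟ᵍ_ A (i₀ , j₀) (i , j₀) ≡ remove _≟ᶠ_ (λ i → A (i , j₀)) i₀ i
    remove-column i = by-cases i (i ≟ᶠ i₀)
      where
      by-cases : ∀ i → Dec (i ≡ i₀) →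
                 remove _≟ᵍ_ A (i₀ , j₀) (i , j₀) ≡ remove _≟ᶠ_ (λ i → A (i , j₀)) i₀ i
      by-cases _ (yes refl) = trans (remove-self _≟ᵍ_ A (i₀ , j₀))
                                    (sym (remove-self _≟ᶠ_ (λ i → A (i , j₀)) i₀))
      by-cases _ (no i≢i₀)  = trans (remove-other _≟ᵍ_ A (i≢i₀ ∘ cong proj₁))
                                    (sym (remove-other _≟ᶠ_ (λ i → A (i , j₀)) i≢i₀))

  unique-length≤grid-count : ∀ (A : Fin a × Fin b → Bool) (S : List (Fin a × Fin b)) →
                             Unique S → (∀ {s} → s ∈ S → A s ≡ true) → length S ≤ grid-count A
  unique-length≤grid-count A []      _            _  = z≤n
  unique-length≤grid-count A (x ∷ S) (x∉S ∷ uniq) S⊆A =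
    ≤-trans (s≤s (unique-length≤grid-count (remove _≟ᵍ_ A x) S uniq S⊆A-x))
            (≤-reflexive (sym (grid-count-remove A x (S⊆A (here refl)))))
    where
    S⊆A-x : ∀ {s} → s ∈ S → remove _≟ᵍ_ A x s ≡ true
    S⊆A-x s∈S = trans (remove-other _≟ᵍ_ A (λ s≡x → lookup x∉S s∈S (sym s≡x))) (S⊆A (there s∈S))

extend : ∀ {n} → (Fin n → Bool) → ℕ → Bool
extend {zero}  f _       = false
extend {suc n} f zero    = f zero
extend {suc n} f (suc j) = extend (f ∘ suc) j

extend-toℕ : ∀ {n} (f : Fin n → Bool) j → extend f (toℕ j) ≡ f j
extend-toℕ f zero    = refl
extend-toℕ f (suc j) = extend-toℕ (f ∘ suc) j

extend-true : ∀ {n} (f : Fin n → Bool) j → extend f j ≡ true → ∃[ jj ] toℕ jj ≡ j × f jj ≡ true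
extend-true {suc n} f zero    e = zero , refl , e
extend-true {suc n} f (suc j) e with extend-true (f ∘ suc) j e
... | jj , refl , fjj = suc jj , refl , fjj

extend-beyond : ∀ {n} (f : Fin n → Bool) j → n ≤ j → extend f j ≡ false
extend-beyond {zero}  f j       _         = refl
extend-beyond {suc n} f (suc j) (s≤s n≤j) = extend-beyond (f ∘ suc) j n≤j

not-does-false : ∀ {A : Set} (x : Dec A) → not (does x) ≡ false → A
not-does-false (yes a) _ = a

not-does-true : ∀ {A : Set} (x : Dec A) → not (does x) ≡ true → ¬ A
not-does-true (no ¬a) _ = ¬a

¬¬-∀-Fin : ∀ n {P : Fin n → Set} → (∀ i → ¬ ¬ P i) → ¬ ¬ (∀ i → P i)
¬¬-∀-Fin zero    _   ¬∀ = ¬∀ (λ ())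
¬¬-∀-Fin (suc n) ¬¬P ¬∀ = ¬¬P zero (λ p₀ → ¬¬-∀-Fin n (λ i → ¬¬P (suc i))
                                       (λ ps → ¬∀ λ { zero → p₀ ; (suc i) → ps i }))

¬¬-decide-grid : ∀ {a b} (Q : Fin a × Fin b → Set) → ¬ ¬ (∀ v → Dec (Q v))
¬¬-decide-grid {a} {b} Q ¬dec =
  ¬¬-∀-Fin a (λ i → ¬¬-∀-Fin b (λ j → ¬¬-excluded-middle)) (λ dec → ¬dec (λ (i , j) → dec i j))

fort-unobserved : ∀ (G : Graph) {S} (F : Graph.V G → Set) →
                  (∀ {s w} → s ∈ S → InN G s w → ¬ F w) →
                  (∀ {v w} → ¬ F v → InN G v w → F w → ∃[ u ] InN G v u × u ≢ w × F u) →
                  ∀ {w} → Observed G S w → ¬ F w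
fort-unobserved G F far fort (dom s∈S s∼w) = far s∈S s∼w
fort-unobserved G F far fort (force v-obs v∼w others) Fw
  with fort (fort-unobserved G F far fort v-obs) v∼w Fw
... | u , v∼u , u≢w , Fu = fort-unobserved G F far fort (others u v∼u u≢w) Fu

-- The grid K k □ P ℓ: vertex (i , j) is row i of layer j.
module Grid (k ℓ : ℕ) where

  G : Graph
  G = K k □ P ℓ

  _∼_ : Fin ℓ → Fin ℓ → Set
  _∼_ = Graph.Adj (P ℓ)

  neighbour-shape : ∀ {i j i′ j′} → InN G (i , j) (i′ , j′) → j′ ≡ j ⊎ (i′ ≡ i × j ∼ j′)
  neighbour-shape (inj₁ refl)                 = inj₁ refl
  neighbour-shape (inj₂ (inj₁ (refl , j∼j′))) = inj₂ (refl , j∼j′)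
  neighbour-shape (inj₂ (inj₂ (_ , refl)))    = inj₁ refl

  same-layer : ∀ i i′ j → InN G (i , j) (i′ , j)
  same-layer i i′ j with i′ ≟ᶠ i
  ... | yes refl = inj₁ refl
  ... | no i′≢i  = inj₂ (inj₂ (i′≢i ∘ sym , refl))

  row-force : ∀ {S i j w} → Observed G S (i , j) → InN G (i , j) w →
              (∀ i′ → (i′ , j) ≢ w → Observed G S (i′ , j)) →
              (∀ j′ → j ∼ j′ → (i , j′) ≢ w → Observed G S (i , j′)) → Observed G S w
  row-force {S} {i} {j} {w} v-obs v∼w layer vertical = force v-obs v∼w others
    where
    others : ∀ u → InN G (i , j) u → u ≢ w → Observed G S u
    others (i′ , j′) v∼u u≢w with neighbour-shape v∼u
    ... | inj₁ refl          = layer i′ u≢w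
    ... | inj₂ (refl , j∼j′) = vertical j′ j∼j′ u≢w

-- The contribution of a hole-free layer to the upper bound: k minus the number
-- of holes of the next layer; layers with holes contribute nothing.
layer-weight : (k holes next : ℕ) → ℕ
layer-weight k zero    next = k ∸ next
layer-weight k (suc _) next = 0

-- The scan over a hole profile U : ℕ → ℕ of a grid with k = d + 2 rows, where
-- U (suc j) counts the holes of layer j and U 0 those of a virtual empty layer.
module HoleProfile (d : ℕ) (U : ℕ → ℕ) where

  weight : ℕ → ℕ
  weight j = layer-weight (suc (suc d)) (U (suc j)) (U (suc (suc j)))

  W : ℕ → ℕ
  W = prefix-sum weight

  W-holey : ∀ {j x} → U (suc j) ≡ suc x → W (suc j) ≡ W j
  W-holey {j} eq rewrite eq = +-identityʳ (W j)

  W-empty : ∀ {j} → U (suc j) ≡ 0 → W (suc j) ≡ W j + (suc (suc d) ∸ U (suc (suc j)))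
  W-empty eq rewrite eq = refl

  -- The constraints satisfied by the hole profile of a failed set, for layers 0 … L.
  module Scan (L : ℕ) (1≤d : 1 ≤ d)
    (U-start : U 0 ≡ 0) (U-end : U (suc (suc L)) ≡ 0)
    (zero-layer : ∀ {j} → j ≤ L → U (suc j) ≡ 0 → U j ≡ U (suc (suc j)))
    (one-layer  : ∀ {j} → j ≤ L → U (suc j) ≡ 1 → suc d ≤ U j + U (suc (suc j))) where

    Spike : ℕ → Set
    Spike j = U j ≡ 0 × U (suc j) ≡ 1

    Within : ℕ → ℕ → Set
    Within j room = ∃[ q ] W (suc j) ≤ d * q × q * 2 ≤ room

    Bounded : ℕ → Set
    Bounded j = Within j j ⊎ (Spike j × Within j (suc j))

    2≰0 : ¬ 2 ≤ 0
    2≰0 ()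

    at-least-two : ∀ {n} → 2 ≤ n → ∃[ y ] n ≡ suc (suc y)
    at-least-two {n} 2≤n = n ∸ 2 , sym (m+[n∸m]≡n 2≤n)

    ≥2⇒≢1 : ∀ {n y} → n ≡ suc (suc y) → n ≢ 1
    ≥2⇒≢1 refl ()

    beside-one-after-empty : ∀ {j} → j ≤ L → U j ≡ 0 → U (suc j) ≡ 1 → 2 ≤ U (suc (suc j))
    beside-one-after-empty {j} j≤L U₀ U₁ =
      ≤-trans (s≤s 1≤d) (subst (suc d ≤_) (cong (_+ U (suc (suc j))) U₀) (one-layer j≤L U₁))

    beside-one-before-empty : ∀ {j} → j ≤ L → U (suc (suc j)) ≡ 0 → U (suc j) ≡ 1 → 2 ≤ U j
    beside-one-before-empty {j} j≤L U₂ U₁ =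
      ≤-trans (s≤s 1≤d)
              (subst (suc d ≤_) (trans (cong (U j +_) U₂) (+-identityʳ (U j))) (one-layer j≤L U₁))

    no-spike : ∀ {j} → Bounded j → U (suc j) ≢ 1 → Within j j
    no-spike (inj₁ w)              _  = w
    no-spike (inj₂ ((_ , U₁) , _)) ≢1 = ⊥-elim (≢1 U₁)

    loosen : ∀ {j} → Bounded j → Within j (suc j)
    loosen (inj₁ (q , W≤ , room)) = q , W≤ , m≤n⇒m≤1+n room
    loosen (inj₂ (_ , w))         = w

    bounded-start : ∀ {x} → U 1 ≡ suc x → Bounded 0
    bounded-start U₁ = inj₁ (0 , ≤-reflexive (trans (W-holey U₁) (sym (*-zeroʳ d))) , z≤n)

    -- Two consecutive layers with holes: nothing is added.
    bounded-after-holey : ∀ {i x} → Bounded i → U (suc (suc i)) ≡ suc x → Bounded (suc i)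
    bounded-after-holey b U₂ with loosen b
    ... | q , W≤ , room = inj₁ (q , ≤-trans (≤-reflexive (W-holey U₂)) W≤ , room)

    -- A hole-free layer between two layers with at least two holes adds at most d.
    bounded-after-light-empty : ∀ {h x} → Within h h → U (suc (suc h)) ≡ 0 →
                                U (suc (suc (suc h))) ≡ suc (suc x) → Bounded (suc (suc h))
    bounded-after-light-empty {h} {x} (q , W≤ , room) U₂ U₃ = inj₁ (suc q , W≤′ , s≤s (s≤s room))
      where
      open ≤-Reasoning
      W≤′ : W (suc (suc (suc h))) ≤ d * suc q
      W≤′ = begin
        W (suc (suc (suc h)))                             ≡⟨ W-holey U₃ ⟩
        W (suc (suc h))                                   ≡⟨ W-empty U₂ ⟩
        W (suc h) + (suc (suc d) ∸ U (suc (suc (suc h)))) ≡⟨ cong (λ u → W (suc h) + (suc (suc d) ∸ u)) U₃ ⟩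
        W (suc h) + (d ∸ x)                               ≤⟨ +-mono-≤ W≤ (m∸n≤m d x) ⟩
        d * q + d                                         ≡⟨ +-comm (d * q) d ⟩
        d + d * q                                         ≡⟨ *-suc d q ⟨
        d * suc q                                         ∎

    -- A hole-free layer between two one-hole layers adds d + 1, but the layer
    -- before them has at least two holes, so four layers add at most 2d.
    bounded-after-heavy-empty : ∀ {g q} → W (suc g) ≤ d * q → q * 2 ≤ g →
                                U (suc (suc g)) ≡ 1 → U (suc (suc (suc g))) ≡ 0 →
                                U (suc (suc (suc (suc g)))) ≡ 1 → Bounded (suc (suc (suc g)))
    bounded-after-heavy-empty {g} {q} W≤ room U₂ U₃ U₄ =
      inj₂ ((U₃ , U₄) , suc (suc q) , W≤′ , s≤s (s≤s (s≤s (s≤s room))))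
      where
      open ≤-Reasoning
      W≤′ : W (suc (suc (suc (suc g)))) ≤ d * suc (suc q)
      W≤′ = begin
        W (suc (suc (suc (suc g))))                 ≡⟨ W-holey U₄ ⟩
        W (suc (suc (suc g)))                       ≡⟨ W-empty U₃ ⟩
        W (suc (suc g)) + (suc (suc d) ∸ U (suc (suc (suc (suc g)))))
                                                    ≡⟨ cong₂ (λ w u → w + (suc (suc d) ∸ u)) (W-holey U₂) U₄ ⟩
        W (suc g) + suc d                           ≤⟨ +-mono-≤ W≤ (+-monoˡ-≤ d 1≤d) ⟩
        d * q + (d + d)                             ≡⟨ +-comm (d * q) (d + d) ⟩
        d + d + d * q                               ≡⟨ +-assoc d d (d * q) ⟩
        d + (d + d * q)                             ≡⟨ cong (d +_) (*-suc d q) ⟨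
        d + d * suc q                               ≡⟨ *-suc d (suc q) ⟨
        d * suc (suc q)                             ∎

    bounded : ∀ j → j ≤ L → ∀ {x} → U (suc j) ≡ suc x → Bounded j
    bounded-after-empty : ∀ i → suc i ≤ L → U (suc i) ≡ 0 →
                          ∀ {x} → U (suc (suc i)) ≡ suc x → Bounded (suc i)
    bounded-before-heavy : ∀ h → suc h ≤ L → U (suc h) ≡ 1 → U (suc (suc h)) ≡ 0 →
                           U (suc (suc (suc h))) ≡ 1 → Bounded (suc (suc h))

    bounded zero    _   U₁ = bounded-start U₁
    bounded (suc i) i<L U₂ = by-previous (U (suc i)) refl
      where
      by-previous : ∀ u → U (suc i) ≡ u → Bounded (suc i)
      by-previous (suc _) U₁ = bounded-after-holey (bounded i (≤-trans (n≤1+n i) i<L) U₁) U₂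
      by-previous zero    U₁ = bounded-after-empty i i<L U₁ U₂

    -- A hole-free layer is flanked by equal hole counts, so it is not layer 0.
    bounded-after-empty zero    _   U₁ U₂ =
      ⊥-elim (0≢1+n (trans (sym U-start) (trans (zero-layer z≤n U₁) U₂)))
    bounded-after-empty (suc h) h<L U₂ {suc x} U₃ =
      bounded-after-light-empty (no-spike (bounded h (≤-trans (n≤1+n h) (<⇒≤ h<L)) U₁) (≥2⇒≢1 U₁)) U₂ U₃
      where
      U₁ : U (suc h) ≡ suc (suc x)
      U₁ = trans (zero-layer (<⇒≤ h<L) U₂) U₃
    bounded-after-empty (suc h) h<L U₂ {zero} U₃ =
      bounded-before-heavy h (<⇒≤ h<L) (trans (zero-layer (<⇒≤ h<L) U₂) U₃) U₂ U₃

    bounded-before-heavy zero    _   U₁ U₂ _ =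
      ⊥-elim (2≰0 (subst (2 ≤_) U-start (beside-one-before-empty z≤n U₂ U₁)))
    bounded-before-heavy (suc g) h<L U₂ U₃ U₄
      with at-least-two (beside-one-before-empty (<⇒≤ h<L) U₃ U₂)
    ... | _ , U₁ with no-spike (bounded g (≤-trans (n≤1+n g) (<⇒≤ h<L)) U₁) (≥2⇒≢1 U₁)
    ...   | q , W≤ , room = bounded-after-heavy-empty W≤ room U₂ U₃ U₄

    zeros-spread-down : ∀ j → j ≤ L → U (suc j) ≡ 0 → U (suc (suc j)) ≡ 0 →
                        ∀ i → i ≤ j → U (suc i) ≡ 0
    zeros-spread-down zero    _   U₁ _  zero    z≤n = U₁
    zeros-spread-down (suc j) j≤L U₁ U₂ i i≤j with m≤n⇒m<n∨m≡n i≤j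
    ... | inj₂ refl = U₁
    ... | inj₁ i<j  = zeros-spread-down j (≤-trans (n≤1+n j) j≤L)
                        (trans (zero-layer j≤L U₁) U₂) U₁ i (s≤s⁻¹ i<j)

    -- If some layer has a hole, the total weight is at most d ⌊L/2⌋: the last
    -- layer has holes and is no spike, so the scan ends with room L.
    W-bound : ¬ (∀ j → j ≤ L → U (suc j) ≡ 0) → W (suc L) ≤ d * (L / 2)
    W-bound some-hole = by-last (U (suc L)) refl
      where
      by-last : ∀ u → U (suc L) ≡ u → W (suc L) ≤ d * (L / 2)
      by-last zero    U₊ = ⊥-elim (some-hole (zeros-spread-down L ≤-refl U₊ U-end))
      by-last (suc _) U₊ with bounded L ≤-refl U₊
      ... | inj₂ ((U₀ , U₁) , _) =
        ⊥-elim (2≰0 (subst (2 ≤_) U-end (beside-one-after-empty ≤-refl U₀ U₁)))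
      ... | inj₁ (q , W≤ , room) =
        ≤-trans W≤ (*-monoʳ-≤ d (subst (_≤ L / 2) (m*n/n≡m q 2) (/-monoˡ-≤ 2 room)))

is-empty : ℕ → Bool
is-empty zero    = true
is-empty (suc _) = false

count-candidates : ∀ {k} u (f : Fin k → Bool) →
                   count (λ i → is-empty u ∧ not (f i)) ≡ layer-weight k u (count f)
count-candidates zero    f = sym (trans (cong (_∸ count f) (sym (count-complement f)))
                                        (m+n∸n≡m (count (not ∘ f)) (count f)))
count-candidates (suc u) f = count-none {f = λ i → is-empty (suc u) ∧ not (f i)} (λ _ → refl)
module UpperBound (d L : ℕ) (S : List (Fin (suc (suc d)) × Fin (suc L)))
                  (observed? : ∀ v → Dec (Observed (K (suc (suc d)) □ P (suc L)) S v)) where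

  open Grid (suc (suc d)) (suc L)

  Obs : Fin (suc (suc d)) × Fin (suc L) → Set
  Obs = Observed G S

  unseen : Fin (suc (suc d)) → Fin (suc L) → Bool
  unseen i j = not (does (observed? (i , j)))

  -- hole i p: row i has an unobserved vertex at position p, where position
  -- suc j is layer j and positions 0 and beyond suc L hold no vertex.
  hole : Fin (suc (suc d)) → ℕ → Bool
  hole i zero    = false
  hole i (suc j) = extend (unseen i) j

  clear-at : ∀ {i p j} → hole i p ≡ false → suc (toℕ j) ≡ p → Obs (i , j)
  clear-at {i} {j = j} clear refl =
    not-does-false (observed? (i , j)) (trans (sym (extend-toℕ (unseen i) j)) clear)

  observed⇒clear : ∀ {i j} → Obs (i , j) → hole i (suc (toℕ j)) ≡ false
  observed⇒clear {i} {j} obs = trans (extend-toℕ (unseen i) j) (cong not (dec-true (observed? (i , j)) obs))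

  hole⇒unobserved : ∀ {i p} → hole i p ≡ true → ∃[ j ] suc (toℕ j) ≡ p × ¬ Obs (i , j)
  hole⇒unobserved {i} {suc q} h with extend-true (unseen i) q h
  ... | j , toℕ-j , unobs = j , cong suc toℕ-j , not-does-true (observed? (i , j)) unobs

  U : ℕ → ℕ
  U p = count (λ i → hole i p)

  open HoleProfile d U

  U-start : U 0 ≡ 0
  U-start = count-none {f = λ i → hole i 0} (λ _ → refl)

  U-end : U (suc (suc L)) ≡ 0
  U-end = count-none {f = λ i → hole i (suc (suc L))} (λ i → extend-beyond (unseen i) (suc L) ≤-refl)

  -- A hole-free layer: every row has a hole on both sides or on neither,
  -- since a single vertical hole next to a fully observed layer gets forced.
  zero-layer : ∀ {j} → j ≤ L → U (suc j) ≡ 0 → U j ≡ U (suc (suc j))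
  zero-layer {j} j≤L U₊ = count-cong row
    where
    jj : Fin (suc L)
    jj = fromℕ< (s≤s j≤L)
    toℕ-jj : toℕ jj ≡ j
    toℕ-jj = toℕ-fromℕ< (s≤s j≤L)
    layer : ∀ i → Obs (i , jj)
    layer i = clear-at (count-zero (λ i → hole i (suc j)) U₊ i) (cong suc toℕ-jj)

    below-forced : ∀ i → hole i j ≡ true → hole i (suc (suc j)) ≡ false → ⊥
    below-forced i below above with hole⇒unobserved below
    ... | jb , pos-b , unobs =
      unobs (row-force (layer i) (inj₂ (inj₁ (refl , inj₂ jj-above))) (λ i′ _ → layer i′) vertical)
      where
      jj-above : toℕ jj ≡ suc (toℕ jb)
      jj-above = trans toℕ-jj (sym pos-b)
      vertical : ∀ j′ → jj ∼ j′ → (i , j′) ≢ (i , jb) → Obs (i , j′)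
      vertical j′ (inj₁ up)   _  = clear-at above (cong suc (trans up (cong suc toℕ-jj)))
      vertical j′ (inj₂ down) ne =
        ⊥-elim (ne (cong (i ,_) (toℕ-injective (suc-injective (trans (sym down) jj-above)))))

    above-forced : ∀ i → hole i (suc (suc j)) ≡ true → hole i j ≡ false → ⊥
    above-forced i above below with hole⇒unobserved above
    ... | ja , pos-a , unobs =
      unobs (row-force (layer i) (inj₂ (inj₁ (refl , inj₁ ja-above))) (λ i′ _ → layer i′) vertical)
      where
      ja-above : toℕ ja ≡ suc (toℕ jj)
      ja-above = trans (suc-injective pos-a) (cong suc (sym toℕ-jj))
      vertical : ∀ j′ → jj ∼ j′ → (i , j′) ≢ (i , ja) → Obs (i , j′)
      vertical j′ (inj₁ up)   ne = ⊥-elim (ne (cong (i ,_) (toℕ-injective (trans up (sym ja-above)))))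
      vertical j′ (inj₂ down) _  = clear-at below (trans (sym down) toℕ-jj)

    row : ∀ i → hole i j ≡ hole i (suc (suc j))
    row i with hole i j in below | hole i (suc (suc j)) in above
    ... | false | false = refl
    ... | true  | true  = refl
    ... | true  | false = ⊥-elim (below-forced i below above)
    ... | false | true  = ⊥-elim (above-forced i above below)

  -- A layer with a single hole a: every row has a hole in the layer or beside
  -- it, since otherwise its vertex in the layer would force a.
  one-layer : ∀ {j} → j ≤ L → U (suc j) ≡ 1 → suc d ≤ U j + U (suc (suc j))
  one-layer {j} j≤L U₊ = s≤s⁻¹ (subst (suc (suc d) ≤_) three-layers
    (count-cover (λ i → hole i j) (λ i → hole i (suc j)) (λ i → hole i (suc (suc j))) covered))
    where
    three-layers : U j + U (suc j) + U (suc (suc j)) ≡ suc (U j + U (suc (suc j)))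
    three-layers = trans (cong (λ u → U j + u + U (suc (suc j))) U₊)
                         (cong (_+ U (suc (suc j))) (+-comm (U j) 1))
    a : Fin (suc (suc d))
    a = proj₁ (count-witness (λ i → hole i (suc j)) U₊)
    a-hole : hole a (suc j) ≡ true
    a-hole = proj₂ (count-witness (λ i → hole i (suc j)) U₊)

    uncovered-forces : ∀ i → hole i j ≡ false → hole i (suc j) ≡ false → hole i (suc (suc j)) ≡ false → ⊥
    uncovered-forces i below inside above with hole⇒unobserved a-hole
    ... | ja , pos-a , unobs = unobs (row-force (clear-at inside pos-a) (same-layer i a ja) layer vertical)
      where
      layer : ∀ i′ → (i′ , ja) ≢ (a , ja) → Obs (i′ , ja)
      layer i′ ne with hole i′ (suc j) in h
      ... | false = clear-at h pos-a
      ... | true  = ⊥-elim (ne (cong (_, ja) (count-unique (λ i → hole i (suc j)) U₊ a-hole h)))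
      vertical : ∀ j′ → ja ∼ j′ → (i , j′) ≢ (a , ja) → Obs (i , j′)
      vertical j′ (inj₁ up)   _ = clear-at above (cong suc (trans up pos-a))
      vertical j′ (inj₂ down) _ = clear-at below (trans (sym down) (suc-injective pos-a))

    covered : ∀ i → (hole i j ∨ hole i (suc j) ∨ hole i (suc (suc j))) ≡ true
    covered i with hole i j in below | hole i (suc j) in inside | hole i (suc (suc j)) in above
    ... | true  | _     | _     = refl
    ... | false | true  | _     = refl
    ... | false | false | true  = refl
    ... | false | false | false = ⊥-elim (uncovered-forces i below inside above)

  holes-exist : ¬ (∀ w → Obs w) → ¬ (∀ j → j ≤ L → U (suc j) ≡ 0)
  holes-exist not-all no-holes =
    not-all (λ (i , j) → clear-at (count-zero (λ i → hole i (suc (toℕ j)))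
                                               (no-holes (toℕ j) (s≤s⁻¹ (toℕ<n j))) i) refl)

  candidate : Fin (suc (suc d)) × Fin (suc L) → Bool
  candidate (i , j) = is-empty (U (suc (toℕ j))) ∧ not (hole i (suc (suc (toℕ j))))

  -- Every vertex of S observes its whole closed neighbourhood.
  S⊆candidates : ∀ {s} → s ∈ S → candidate s ≡ true
  S⊆candidates {i , j} s∈S = candidate-intro layer-clear above-clear
    where
    candidate-intro : U (suc (toℕ j)) ≡ 0 → hole i (suc (suc (toℕ j))) ≡ false → candidate (i , j) ≡ true
    candidate-intro U₀ clear rewrite U₀ | clear = refl
    layer-clear : U (suc (toℕ j)) ≡ 0
    layer-clear = count-none {f = λ i′ → hole i′ (suc (toℕ j))}
                    (λ i′ → observed⇒clear (dom s∈S (same-layer i i′ j)))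
    above-clear : hole i (suc (suc (toℕ j))) ≡ false
    above-clear with hole i (suc (suc (toℕ j))) in h
    ... | false = refl
    ... | true with hole⇒unobserved h
    ...   | ja , pos-a , unobs = ⊥-elim (unobs (dom s∈S (inj₂ (inj₁ (refl , inj₁ (suc-injective pos-a))))))

  bound : 1 ≤ d → Unique S → ¬ (∀ w → Obs w) → length S ≤ d * (L / 2)
  bound 1≤d uniq not-all = begin
    length S                          ≤⟨ unique-length≤grid-count candidate S uniq S⊆candidates ⟩
    grid-count candidate              ≡⟨ sum-cong-≗ {suc L} layer-candidates ⟩
    ∑[ j < suc L ] weight (toℕ j)     ≡⟨ sum-toℕ (suc L) weight ⟩
    W (suc L)                         ≤⟨ W-bound (holes-exist not-all) ⟩
    d * (L / 2)                       ∎
    where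
    open ≤-Reasoning
    open Scan L 1≤d U-start U-end zero-layer one-layer
    layer-candidates : ∀ j → count (λ i → candidate (i , j)) ≡ weight (toℕ j)
    layer-candidates j = count-candidates (U (suc (toℕ j))) (λ i → hole i (suc (suc (toℕ j))))

-- Upper bound: every failed power dominating set has at most d ⌊L/2⌋ vertices.
-- The bound is decidable, so observedness may be assumed decidable.
upper-bound : ∀ d L → 1 ≤ d → ∀ S → Unique S → IsFPDS (K (suc (suc d)) □ P (suc L)) S →
              length S ≤ d * (L / 2)
upper-bound d L 1≤d S uniq fails = decidable-stable (length S ≤? d * (L / 2)) λ ¬bound →
  ¬¬-decide-grid (Observed (K (suc (suc d)) □ P (suc L)) S)
                 (λ observed? → ¬bound (UpperBound.bound d L S observed? 1≤d uniq fails))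

length-cartesianProduct : ∀ {A B : Set} (xs : List A) (ys : List B) →
                          length (cartesianProduct xs ys) ≡ length xs * length ys
length-cartesianProduct []       ys = refl
length-cartesianProduct (x ∷ xs) ys =
  trans (length-++ (map (x ,_) ys)) (cong₂ _+_ (length-map (x ,_) ys) (length-cartesianProduct xs ys))

odd : ℕ → Bool
odd zero    = false
odd (suc n) = not (odd n)

odd-double : ∀ t → odd (t * 2) ≡ false
odd-double zero    = refl
odd-double (suc t) = cong (not ∘ not) (odd-double t)

odd-pred : ∀ {b} → odd (suc b) ≡ true → odd b ≡ false
odd-pred {b} o with odd b
... | false = refl

≢2+ : ∀ n → n ≢ suc (suc n)
≢2+ n = <⇒≢ (≤-trans (n<1+n n) (n≤1+n _))

module LowerBound (d L : ℕ) where

  open Grid (suc (suc d)) (suc L)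

  small : Fin (suc (suc d)) → Bool
  small zero          = true
  small (suc zero)    = true
  small (suc (suc _)) = false

  partner : Fin (suc (suc d)) → Fin (suc (suc d))
  partner zero    = suc zero
  partner (suc _) = zero

  partner-small : ∀ i → small (partner i) ≡ true
  partner-small zero    = refl
  partner-small (suc _) = refl

  partner-≢ : ∀ {i} → small i ≡ true → partner i ≢ i
  partner-≢ {zero}       _ ()
  partner-≢ {suc zero}   _ ()

  marked : Fin (suc L) → Bool
  marked j = odd (toℕ j) ∧ (toℕ j <ᵇ L)

  marked-odd : ∀ {j} → marked j ≡ true → odd (toℕ j) ≡ true
  marked-odd m = to T-≡ (proj₁ (to T-∧ (from T-≡ m)))

  marked-below-last : ∀ {j} → marked j ≡ true → toℕ j < L
  marked-below-last {j} m = <ᵇ⇒< (toℕ j) L (proj₂ (to T-∧ (from T-≡ m)))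

  marked-intro : ∀ {j} → odd (toℕ j) ≡ true → toℕ j < L → marked j ≡ true
  marked-intro o lt = to T-≡ (from T-∧ (from T-≡ o , <⇒<ᵇ lt))

  even-unmarked : ∀ {j} → odd (toℕ j) ≡ false → marked j ≡ false
  even-unmarked e rewrite e = refl

  Fort : Fin (suc (suc d)) × Fin (suc L) → Set
  Fort (i , j) = small i ≡ true × marked j ≡ false

  big-outside-fort : ∀ {i j} → marked j ≡ false → ¬ Fort (i , j) → small i ≡ false
  big-outside-fort {i} unmarked ¬F with small i in s
  ... | true  = ⊥-elim (¬F (refl , unmarked))
  ... | false = refl

  marked-outside-fort : ∀ {i j} → small i ≡ true → ¬ Fort (i , j) → marked j ≡ true
  marked-outside-fort {j = j} s ¬F with marked j in m
  ... | true  = refl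
  ... | false = ⊥-elim (¬F (s , refl))

  vertical-partner : ∀ {j j′} → marked j ≡ true → j ∼ j′ →
                     ∃[ j″ ] j ∼ j″ × j″ ≢ j′ × marked j″ ≡ false
  vertical-partner {j} {j′} m (inj₁ up) = below (toℕ j) refl
    where
    below : ∀ t → toℕ j ≡ t → ∃[ j″ ] j ∼ j″ × j″ ≢ j′ × marked j″ ≡ false
    below zero    t₀ = ⊥-elim (true≢false (marked-odd m) (cong odd t₀))
    below (suc b) tb = jb , inj₂ (trans tb (cong suc (sym toℕ-jb))) , jb≢j′ ,
                       even-unmarked (trans (cong odd toℕ-jb) (odd-pred {b} (trans (cong odd (sym tb)) (marked-odd m))))
      where
      b<ℓ : b < suc L
      b<ℓ = ≤-trans (n≤1+n _) (subst (_< suc L) tb (toℕ<n j))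
      jb : Fin (suc L)
      jb = fromℕ< b<ℓ
      toℕ-jb : toℕ jb ≡ b
      toℕ-jb = toℕ-fromℕ< b<ℓ
      jb≢j′ : jb ≢ j′
      jb≢j′ refl = ≢2+ b (trans (sym toℕ-jb) (trans up (cong suc tb)))
  vertical-partner {j} {j′} m (inj₂ down) =
    ja , inj₁ toℕ-ja , ja≢j′ , even-unmarked (trans (cong odd toℕ-ja) (cong not (marked-odd m)))
    where
    ja : Fin (suc L)
    ja = fromℕ< (s≤s (marked-below-last m))
    toℕ-ja : toℕ ja ≡ suc (toℕ j)
    toℕ-ja = toℕ-fromℕ< (s≤s (marked-below-last m))
    ja≢j′ : ja ≢ j′
    ja≢j′ refl = ≢2+ (toℕ ja) (trans toℕ-ja (cong suc down))

  fort-property : ∀ {v w} → ¬ Fort v → InN G v w → Fort w → ∃[ u ] InN G v u × u ≢ w × Fort u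
  fort-property {i , j} {i′ , j′} ¬F v∼w (small-i′ , unmarked) with neighbour-shape v∼w
  ... | inj₁ refl =
    (partner i′ , j) , inj₂ (inj₂ (i≢partner , refl)) , (partner-≢ small-i′ ∘ cong proj₁) ,
    partner-small i′ , unmarked
    where
    i≢partner : i ≢ partner i′
    i≢partner i≡p = true≢false (trans (cong small i≡p) (partner-small i′)) (big-outside-fort unmarked ¬F)
  ... | inj₂ (refl , j∼j′) with vertical-partner (marked-outside-fort small-i′ ¬F) j∼j′
  ...   | j″ , j∼j″ , j″≢j′ , unmarked″ =
    (i , j″) , inj₂ (inj₁ (refl , j∼j″)) , (j″≢j′ ∘ cong proj₂) , small-i′ , unmarked″

  big-rows : List (Fin (suc (suc d)))
  big-rows = tabulate {n = d} (λ r → suc (suc r))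

  room : (t : Fin (L / 2)) → suc (suc (toℕ t * 2)) ≤ L
  room t = ≤-trans (*-monoˡ-≤ 2 (toℕ<n t)) (m/n*n≤m L 2)

  marked-layer : Fin (L / 2) → Fin (suc L)
  marked-layer t = fromℕ< (s≤s (≤-trans (n≤1+n _) (room t)))

  toℕ-marked-layer : ∀ t → toℕ (marked-layer t) ≡ suc (toℕ t * 2)
  toℕ-marked-layer t = toℕ-fromℕ< (s≤s (≤-trans (n≤1+n _) (room t)))

  marked-layer-marked : ∀ t → marked (marked-layer t) ≡ true
  marked-layer-marked t = marked-intro (trans (cong odd (toℕ-marked-layer t)) (cong not (odd-double (toℕ t))))
                                       (subst (_< L) (sym (toℕ-marked-layer t)) (room t))

  marked-layer-injective : ∀ {t u} → marked-layer t ≡ marked-layer u → t ≡ u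
  marked-layer-injective {t} {u} eq = toℕ-injective (*-cancelʳ-≡ (toℕ t) (toℕ u) 2
    (suc-injective (trans (sym (toℕ-marked-layer t)) (trans (cong toℕ eq) (toℕ-marked-layer u)))))

  S : List (Fin (suc (suc d)) × Fin (suc L))
  S = cartesianProduct big-rows (tabulate marked-layer)

  S-unique : Unique S
  S-unique = cartesianProduct⁺ (tabulate⁺ (fsuc-injective ∘ fsuc-injective)) (tabulate⁺ marked-layer-injective)

  S-length : length S ≡ d * (L / 2)
  S-length = trans (length-cartesianProduct big-rows (tabulate marked-layer))
                   (cong₂ _*_ (length-tabulate {n = d} (λ r → suc (suc r))) (length-tabulate marked-layer))

  S-far-from-fort : ∀ {s w} → s ∈ S → InN G s w → ¬ Fort w
  S-far-from-fort {i , j} s∈S s∼w (small-i′ , unmarked)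
    with ∈-cartesianProduct⁻ big-rows (tabulate marked-layer) s∈S
  ... | i∈ , j∈ with ∈-tabulate⁻ i∈ | ∈-tabulate⁻ j∈ | neighbour-shape s∼w
  ...   | _ , refl | t , refl | inj₁ refl       = true≢false (marked-layer-marked t) unmarked
  ...   | _ , refl | _ , refl | inj₂ (refl , _) = true≢false small-i′ refl

  -- The fort contains vertex (0 , 0), so S fails.
  S-fails : IsFPDS G S
  S-fails all-observed = fort-unobserved G Fort S-far-from-fort fort-property (all-observed (zero , zero)) (refl , refl)

-- The main theorem: write k = d + 2 and ℓ = L + 1, so that the claimed value
-- is d ⌊L/2⌋; the lower bound supplies the set, the upper bound its maximality.
theorem8 : (k ℓ : ℕ) → 3 ≤ k → 3 ≤ ℓ →
    FailedPowerDominationNumber (K k □ P ℓ) ((k ∸ 2) * ((ℓ ∸ 1) / 2))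
theorem8 (suc (suc (suc c))) (suc L) (s≤s (s≤s (s≤s _))) (s≤s _) =
  (S , S-unique , S-fails , S-length) , upper-bound (suc c) L (s≤s z≤n)
  where open LowerBound (suc c) L
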